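{- Let $q\ge 2$, $p\in\{1,\dots,q-1\}$ with $\gcd(p,q)=1$, and let $p'\in\{1,\dots,q-1\}$ satisfy $pp'\equiv 1\pmod q$. Let $\Lambda(p,q)=\mathbb{Z}\cdot(1/q,-1/q,p/q)+\mathbb{Z}^3$, and consider the triangles $t_1=\mathrm{conv}\{(0,0,0),(1,-1,0),(1,-1,1/2)\}$ and $t_2=\mathrm{conv}\{(0,0,0),(1,-1,0),(1/2,-1/2,1/2)\}$. Then the point $(p'/q,-p'/q,1/q)\in\Lambda(p,q)$ lies in $t_2$ for all such $(p,q)$, and it lies in $t_1$ if $p\in\{2,\dots,q-2\}$. -}

module Defs where

open import Data.Nat as ℕ using (ℕ)
open import Data.Integer as ℤ using (ℤ; +_)
open import Data.Rational using (ℚ; _+_; _*_; -_; _≤_; 0ℚ; 1ℚ; _/_; ½)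
open import Data.Product using (_×_; _,_; ∃-syntax)
open import Relation.Binary.PropositionalEquality using (_≡_)

fromℤ : ℤ → ℚ
fromℤ z = z / 1

ℚ³ : Set
ℚ³ = ℚ × ℚ × ℚ

_⊕_ : ℚ³ → ℚ³ → ℚ³
(a , b , c) ⊕ (a' , b' , c') = (a + a' , b + b' , c + c')

_⊙_ : ℚ → ℚ³ → ℚ³
r ⊙ (a , b , c) = (r * a , r * b , r * c)

InConv3 : ℚ³ → ℚ³ → ℚ³ → ℚ³ → Set
InConv3 a b c x =
  ∃[ l₁ ] ∃[ l₂ ] ∃[ l₃ ]
    (0ℚ ≤ l₁ × 0ℚ ≤ l₂ × 0ℚ ≤ l₃ × l₁ + l₂ + l₃ ≡ 1ℚ ×
     x ≡ (l₁ ⊙ a) ⊕ ((l₂ ⊙ b) ⊕ (l₃ ⊙ c)))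

gen : (p q : ℕ) → .{{_ : ℕ.NonZero q}} → ℚ³
gen p q = (+ 1 / q , ℤ.- (+ 1) / q , + p / q)

InΛ : (p q : ℕ) → .{{_ : ℕ.NonZero q}} → ℚ³ → Set
InΛ p q x = ∃[ k ] ∃[ z₁ ] ∃[ z₂ ] ∃[ z₃ ]
  (x ≡ (fromℤ k ⊙ gen p q) ⊕ (fromℤ z₁ , fromℤ z₂ , fromℤ z₃))

origin e : ℚ³
origin = (0ℚ , 0ℚ , 0ℚ)
e = (1ℚ , - 1ℚ , 0ℚ)

InT₁ : ℚ³ → Set
InT₁ = InConv3 origin e (1ℚ , - 1ℚ , ½)

InT₂ : ℚ³ → Set
InT₂ = InConv3 origin e (½ , - ½ , ½)

thePoint : (p' q : ℕ) → .{{_ : ℕ.NonZero q}} → ℚ³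
thePoint p' q = (+ p' / q , ℤ.- (+ p') / q , + 1 / q)

-- Write p p' = 1 + m q. Then (p'/q, -p'/q, 1/q) = p' (1/q, -1/q, p/q) - (0, 0, m), so the point lies in Λ(p,q).
-- Both triangles are conv{0, e, (t, -t, 1/2)} with e = (1, -1, 0), and the point has barycentric coordinates
-- ((q - p' - 1)/q, (p' - 1)/q, 2/q) for t = 1/2 (triangle t₂) and ((q - p')/q, (p' - 2)/q, 2/q) for t = 1
-- (triangle t₁). These are nonnegative because 1 ≤ p' < q, and for t₁ because p' ≠ 1: otherwise p ≡ 1 (mod q).

module Submission where

open import Defs

module Membership where

  open import Data.Integer as ℤ using (ℤ; +_)
  import Data.Integer.Properties as ℤP
  open import Data.Integer.Tactic.RingSolver using (solve-∀)
  open import Data.Nat as ℕ using (ℕ; zero; suc; s≤s)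
  import Data.Nat.Properties as ℕP
  open import Data.Product using (_,_)
  open import Data.Rational using (ℚ; _+_; _*_; -_; _/_; _≤_; 0ℚ; 1ℚ; ½; toℚᵘ)
  open import Data.Rational.Properties
    using ( toℚᵘ-injective; toℚᵘ-fromℚᵘ; toℚᵘ-homo-+; toℚᵘ-homo-*; toℚᵘ-homo‿-
          ; nonNegative⁻¹; normalize-nonNeg; *-zeroʳ; *-identityʳ; +-identityˡ; +-identityʳ; +-comm)
  open import Data.Rational.Solver using (module +-*-Solver)
  open import Data.Rational.Unnormalised as ℚᵘ using (*≡*) renaming (_/_ to _/ᵘ_; _≃_ to _≃ᵘ_)
  import Data.Rational.Unnormalised.Properties as ℚᵘ
  open import Relation.Binary.PropositionalEquality
    using (_≡_; refl; sym; trans; cong; cong₂; subst; module ≡-Reasoning)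
  open +-*-Solver using (solve; _:=_; _:+_; _:*_; :-_; con)

  -- Identities between fractions are proved in ℚᵘ, where i / n is the unreduced pair (i, n).
  toℚᵘ-/ : ∀ (i : ℤ) (n : ℕ) .{{_ : ℕ.NonZero n}} → toℚᵘ (i / n) ≃ᵘ i /ᵘ n
  toℚᵘ-/ i (suc k) = toℚᵘ-fromℚᵘ (ℚᵘ.mkℚᵘ i k)

  /-distribʳ-+ : ∀ (i j : ℤ) (n : ℕ) .{{_ : ℕ.NonZero n}} → (i ℤ.+ j) / n ≡ i / n + j / n
  /-distribʳ-+ i j n@(suc _) = toℚᵘ-injective (begin
    toℚᵘ ((i ℤ.+ j) / n)             ≈⟨ toℚᵘ-/ (i ℤ.+ j) n ⟩
    (i ℤ.+ j) /ᵘ n                   ≈⟨ *≡* (distrib i j (+ n)) ⟩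
    i /ᵘ n ℚᵘ.+ j /ᵘ n               ≈⟨ ℚᵘ.+-cong (toℚᵘ-/ i n) (toℚᵘ-/ j n) ⟨
    toℚᵘ (i / n) ℚᵘ.+ toℚᵘ (j / n)   ≈⟨ toℚᵘ-homo-+ (i / n) (j / n) ⟨
    toℚᵘ (i / n + j / n)             ∎)
    where
    open ℚᵘ.≃-Reasoning
    distrib : ∀ i j d → (i ℤ.+ j) ℤ.* (d ℤ.* d) ≡ (i ℤ.* d ℤ.+ j ℤ.* d) ℤ.* d
    distrib = solve-∀

  fromℤ-*-/ : ∀ (i j : ℤ) (n : ℕ) .{{_ : ℕ.NonZero n}} → fromℤ i * (j / n) ≡ (i ℤ.* j) / n
  fromℤ-*-/ i j n@(suc _) = toℚᵘ-injective (begin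
    toℚᵘ (fromℤ i * (j / n))           ≈⟨ toℚᵘ-homo-* (fromℤ i) (j / n) ⟩
    toℚᵘ (fromℤ i) ℚᵘ.* toℚᵘ (j / n)   ≈⟨ ℚᵘ.*-cong (toℚᵘ-/ i 1) (toℚᵘ-/ j n) ⟩
    (i /ᵘ 1) ℚᵘ.* (j /ᵘ n)             ≈⟨ *≡* (unit i j (+ n)) ⟩
    (i ℤ.* j) /ᵘ n                     ≈⟨ toℚᵘ-/ (i ℤ.* j) n ⟨
    toℚᵘ ((i ℤ.* j) / n)               ∎)
    where
    open ℚᵘ.≃-Reasoning
    unit : ∀ i j d → (i ℤ.* j) ℤ.* d ≡ (i ℤ.* j) ℤ.* (+ 1 ℤ.* d)
    unit = solve-∀

  fromℤ-/ : ∀ (i : ℤ) (n : ℕ) .{{_ : ℕ.NonZero n}} → fromℤ i ≡ (i ℤ.* + n) / n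
  fromℤ-/ i n@(suc _) = toℚᵘ-injective (begin
    toℚᵘ (fromℤ i)         ≈⟨ toℚᵘ-/ i 1 ⟩
    i /ᵘ 1                 ≈⟨ *≡* (scale i (+ n)) ⟩
    (i ℤ.* + n) /ᵘ n       ≈⟨ toℚᵘ-/ (i ℤ.* + n) n ⟨
    toℚᵘ ((i ℤ.* + n) / n) ∎)
    where
    open ℚᵘ.≃-Reasoning
    scale : ∀ i d → i ℤ.* d ≡ (i ℤ.* d) ℤ.* + 1
    scale = solve-∀

  neg-/ : ∀ (i : ℤ) (n : ℕ) .{{_ : ℕ.NonZero n}} → (ℤ.- i) / n ≡ - (i / n)
  neg-/ i n@(suc _) = toℚᵘ-injective (begin
    toℚᵘ ((ℤ.- i) / n)   ≈⟨ toℚᵘ-/ (ℤ.- i) n ⟩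
    ℚᵘ.- (i /ᵘ n)        ≈⟨ ℚᵘ.-‿cong (toℚᵘ-/ i n) ⟨
    ℚᵘ.- toℚᵘ (i / n)    ≈⟨ toℚᵘ-homo‿- (i / n) ⟨
    toℚᵘ (- (i / n))     ∎)
    where open ℚᵘ.≃-Reasoning

  n/n≡1 : ∀ (n : ℕ) .{{_ : ℕ.NonZero n}} → + n / n ≡ 1ℚ
  n/n≡1 n = trans (cong (_/ n) (sym (ℤP.*-identityˡ (+ n)))) (sym (fromℤ-/ (+ 1) n))

  2/n*½≡1/n : ∀ (n : ℕ) .{{_ : ℕ.NonZero n}} → + 2 / n * ½ ≡ + 1 / n
  2/n*½≡1/n n = begin
    + 2 / n * ½              ≡⟨ cong (_* ½) (/-distribʳ-+ (+ 1) (+ 1) n) ⟩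
    (+ 1 / n + + 1 / n) * ½  ≡⟨ solve 1 (λ x → (x :+ x) :* con ½ := x) refl (+ 1 / n) ⟩
    + 1 / n                  ∎
    where open ≡-Reasoning

  0≤n/d : ∀ (n d : ℕ) .{{_ : ℕ.NonZero d}} → 0ℚ ≤ + n / d
  0≤n/d n d = nonNegative⁻¹ (+ n / d) {{normalize-nonNeg n d}}

  cong-ℚ³ : ∀ {x y z x' y' z' : ℚ} → x ≡ x' → y ≡ y' → z ≡ z' → (x , y , z) ≡ (x' , y' , z')
  cong-ℚ³ refl refl refl = refl

  scaled-origin-⊕ : ∀ (l : ℚ) (v : ℚ³) → (l ⊙ origin) ⊕ v ≡ v
  scaled-origin-⊕ l (x , y , z) rewrite *-zeroʳ l = cong-ℚ³ (+-identityˡ x) (+-identityˡ y) (+-identityˡ z)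

  InConv3-origin : ∀ (b c : ℚ³) {l₁ l₂ l₃ : ℚ} → 0ℚ ≤ l₁ → 0ℚ ≤ l₂ → 0ℚ ≤ l₃ → l₁ + l₂ + l₃ ≡ 1ℚ →
                   InConv3 origin b c ((l₂ ⊙ b) ⊕ (l₃ ⊙ c))
  InConv3-origin b c {l₁} {l₂} {l₃} 0≤l₁ 0≤l₂ 0≤l₃ sum≡1 =
    l₁ , l₂ , l₃ , 0≤l₁ , 0≤l₂ , 0≤l₃ , sum≡1 , sym (scaled-origin-⊕ l₁ _)

  InConv3-origin-/ : ∀ (b c : ℚ³) (n₂ n₃ q : ℕ) .{{_ : ℕ.NonZero q}} → n₂ ℕ.+ n₃ ℕ.≤ q →
                     InConv3 origin b c (((+ n₂ / q) ⊙ b) ⊕ ((+ n₃ / q) ⊙ c))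
  InConv3-origin-/ b c n₂ n₃ q n₂+n₃≤q =
    InConv3-origin b c (0≤n/d n₁ q) (0≤n/d n₂ q) (0≤n/d n₃ q) (begin
      + n₁ / q + + n₂ / q + + n₃ / q    ≡⟨ cong (_+ + n₃ / q) (/-distribʳ-+ (+ n₁) (+ n₂) q) ⟨
      + (n₁ ℕ.+ n₂) / q + + n₃ / q      ≡⟨ /-distribʳ-+ (+ (n₁ ℕ.+ n₂)) (+ n₃) q ⟨
      + (n₁ ℕ.+ n₂ ℕ.+ n₃) / q          ≡⟨ cong (λ m → + m / q) n₁+n₂+n₃≡q ⟩
      + q / q                           ≡⟨ n/n≡1 q ⟩
      1ℚ                                ∎)
    where
    open ≡-Reasoning
    n₁ = q ℕ.∸ (n₂ ℕ.+ n₃)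
    n₁+n₂+n₃≡q : n₁ ℕ.+ n₂ ℕ.+ n₃ ≡ q
    n₁+n₂+n₃≡q = trans (ℕP.+-assoc n₁ n₂ n₃) (ℕP.m∸n+n≡m n₂+n₃≤q)

  e-apex-combination : ∀ (l₂ l₃ t s : ℚ) →
                       (l₂ ⊙ e) ⊕ (l₃ ⊙ (t , - t , s)) ≡ (l₂ + l₃ * t , - (l₂ + l₃ * t) , l₃ * s)
  e-apex-combination l₂ l₃ t s = cong-ℚ³
    (solve 3 (λ l₂ l₃ t → l₂ :* con 1ℚ :+ l₃ :* t := l₂ :+ l₃ :* t) refl l₂ l₃ t)
    (solve 3 (λ l₂ l₃ t → l₂ :* con (- 1ℚ) :+ l₃ :* (:- t) := :- (l₂ :+ l₃ :* t)) refl l₂ l₃ t)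
    (solve 3 (λ l₂ l₃ s → l₂ :* con 0ℚ :+ l₃ :* s := l₃ :* s) refl l₂ l₃ s)

  thePoint-on-e-apex : ∀ (p' a q : ℕ) .{{_ : ℕ.NonZero q}} (t : ℚ) → + p' / q ≡ + a / q + + 2 / q * t →
                       thePoint p' q ≡ ((+ a / q) ⊙ e) ⊕ ((+ 2 / q) ⊙ (t , - t , ½))
  thePoint-on-e-apex p' a q t x≡ = trans
    (cong-ℚ³ x≡ (trans (neg-/ (+ p') q) (cong -_ x≡)) (sym (2/n*½≡1/n q)))
    (sym (e-apex-combination (+ a / q) (+ 2 / q) t ½))

  thePoint∈t₂ : ∀ (p' q : ℕ) .{{_ : ℕ.NonZero q}} → 1 ℕ.≤ p' → p' ℕ.< q → InT₂ (thePoint p' q)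
  thePoint∈t₂ (suc a) q _ 2+a≤q =
    subst InT₂ (sym (thePoint-on-e-apex (suc a) a q ½ x≡))
      (InConv3-origin-/ e (½ , - ½ , ½) a 2 q (subst (ℕ._≤ q) (ℕP.+-comm 2 a) 2+a≤q))
    where
    open ≡-Reasoning
    x≡ : + suc a / q ≡ + a / q + + 2 / q * ½
    x≡ = begin
      + suc a / q              ≡⟨ /-distribʳ-+ (+ 1) (+ a) q ⟩
      + 1 / q + + a / q        ≡⟨ +-comm (+ 1 / q) (+ a / q) ⟩
      + a / q + + 1 / q        ≡⟨ cong (_+_ (+ a / q)) (2/n*½≡1/n q) ⟨
      + a / q + + 2 / q * ½    ∎

  thePoint∈t₁ : ∀ (p' q : ℕ) .{{_ : ℕ.NonZero q}} → 2 ℕ.≤ p' → p' ℕ.≤ q → InT₁ (thePoint p' q)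
  thePoint∈t₁ (suc zero) q (s≤s ()) _
  thePoint∈t₁ (suc (suc a)) q _ 2+a≤q =
    subst InT₁ (sym (thePoint-on-e-apex (2 ℕ.+ a) a q 1ℚ x≡))
      (InConv3-origin-/ e (1ℚ , - 1ℚ , ½) a 2 q (subst (ℕ._≤ q) (ℕP.+-comm 2 a) 2+a≤q))
    where
    open ≡-Reasoning
    x≡ : + (2 ℕ.+ a) / q ≡ + a / q + + 2 / q * 1ℚ
    x≡ = begin
      + (2 ℕ.+ a) / q          ≡⟨ /-distribʳ-+ (+ 2) (+ a) q ⟩
      + 2 / q + + a / q        ≡⟨ +-comm (+ 2 / q) (+ a / q) ⟩
      + a / q + + 2 / q        ≡⟨ cong (_+_ (+ a / q)) (*-identityʳ (+ 2 / q)) ⟨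
      + a / q + + 2 / q * 1ℚ   ∎

  bézout-ℤ : ∀ (p p' q m : ℕ) → p ℕ.* p' ≡ 1 ℕ.+ m ℕ.* q → + p' ℤ.* + p ℤ.+ ℤ.- (+ m) ℤ.* + q ≡ + 1
  bézout-ℤ p p' q m pp'≡1+mq = begin
    + p' ℤ.* + p ℤ.+ ℤ.- (+ m) ℤ.* + q          ≡⟨ cong (ℤ._+ ℤ.- (+ m) ℤ.* + q) p'p≡1+mq ⟩
    + 1 ℤ.+ + m ℤ.* + q ℤ.+ ℤ.- (+ m) ℤ.* + q   ≡⟨ cancel (+ m) (+ q) ⟩
    + 1                                         ∎
    where
    open ≡-Reasoning
    p'p≡1+mq : + p' ℤ.* + p ≡ + 1 ℤ.+ + m ℤ.* + q
    p'p≡1+mq = begin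
      + p' ℤ.* + p             ≡⟨ ℤP.*-comm (+ p') (+ p) ⟩
      + p ℤ.* + p'             ≡⟨ ℤP.pos-* p p' ⟨
      + (p ℕ.* p')             ≡⟨ cong +_ pp'≡1+mq ⟩
      + (1 ℕ.+ m ℕ.* q)        ≡⟨ ℤP.pos-+ 1 (m ℕ.* q) ⟩
      + 1 ℤ.+ + (m ℕ.* q)      ≡⟨ cong (ℤ._+_ (+ 1)) (ℤP.pos-* m q) ⟩
      + 1 ℤ.+ + m ℤ.* + q      ∎
    cancel : ∀ m q → + 1 ℤ.+ m ℤ.* q ℤ.+ ℤ.- m ℤ.* q ≡ + 1
    cancel = solve-∀

  thePoint∈Λ : ∀ (p p' q m : ℕ) .{{_ : ℕ.NonZero q}} → p ℕ.* p' ≡ 1 ℕ.+ m ℕ.* q → InΛ p q (thePoint p' q)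
  thePoint∈Λ p p' q m pp'≡1+mq =
    + p' , + 0 , + 0 , ℤ.- (+ m) ,
    cong-ℚ³ (sym (p'⊙gen (+ 1) (ℤP.*-identityʳ (+ p'))))
            (sym (p'⊙gen (ℤ.- (+ 1)) (trans (ℤP.*-comm (+ p') ℤ.-1ℤ) (ℤP.-1*i≡-i (+ p')))))
            (sym third)
    where
    open ≡-Reasoning
    p'⊙gen : ∀ {k : ℤ} (j : ℤ) → + p' ℤ.* j ≡ k → fromℤ (+ p') * (j / q) + 0ℚ ≡ k / q
    p'⊙gen {k} j p'j≡k = begin
      fromℤ (+ p') * (j / q) + 0ℚ   ≡⟨ +-identityʳ _ ⟩
      fromℤ (+ p') * (j / q)        ≡⟨ fromℤ-*-/ (+ p') j q ⟩
      (+ p' ℤ.* j) / q              ≡⟨ cong (_/ q) p'j≡k ⟩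
      k / q                         ∎
    third : fromℤ (+ p') * (+ p / q) + fromℤ (ℤ.- (+ m)) ≡ + 1 / q
    third = begin
      fromℤ (+ p') * (+ p / q) + fromℤ (ℤ.- (+ m))
        ≡⟨ cong₂ _+_ (fromℤ-*-/ (+ p') (+ p) q) (fromℤ-/ (ℤ.- (+ m)) q) ⟩
      (+ p' ℤ.* + p) / q + (ℤ.- (+ m) ℤ.* + q) / q
        ≡⟨ /-distribʳ-+ (+ p' ℤ.* + p) (ℤ.- (+ m) ℤ.* + q) q ⟨
      (+ p' ℤ.* + p ℤ.+ ℤ.- (+ m) ℤ.* + q) / q
        ≡⟨ cong (_/ q) (bézout-ℤ p p' q m pp'≡1+mq) ⟩
      + 1 / q
        ∎

open Membership

open import Data.Nat using (ℕ; suc; _+_; _*_; _∸_; _≤_; _<_; s≤s; z≤n; NonZero)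
open import Data.Nat.DivMod using (_%_; _/_; m≡m%n+[m/n]*n; m<n⇒m%n≡m)
open import Data.Nat.GCD using (gcd)
open import Data.Nat.Properties using (*-identityʳ; <⇒≤; <-trans; >⇒≢)
open import Data.Product using (_×_; _,_)
open import Relation.Binary.PropositionalEquality using (_≡_; trans; cong; module ≡-Reasoning)
open import Relation.Nullary using (contradiction)

m%n≡1⇒m≡1+[m/n]*n : ∀ (m n : ℕ) .{{_ : NonZero n}} → 2 ≤ n → m % n ≡ 1 % n → m ≡ 1 + (m / n) * n
m%n≡1⇒m≡1+[m/n]*n m n 2≤n m%n≡1 =
  trans (m≡m%n+[m/n]*n m n) (cong (_+ (m / n) * n) (trans m%n≡1 (m<n⇒m%n≡m 2≤n)))

2≤p⇒2≤p' : ∀ {p p' q : ℕ} .{{_ : NonZero q}} → 2 ≤ p → p < q → 1 ≤ p' → (p * p') % q ≡ 1 % q → 2 ≤ p'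
2≤p⇒2≤p' {p' = suc (suc _)} _ _ _ _ = s≤s (s≤s z≤n)
2≤p⇒2≤p' {p} {p' = 1} {q} 2≤p p<q _ p*1%q≡1 = contradiction p≡1 (>⇒≢ 2≤p)
  where
  open ≡-Reasoning
  p≡1 : p ≡ 1
  p≡1 = begin
    p            ≡⟨ m<n⇒m%n≡m p<q ⟨
    p % q        ≡⟨ cong (_% q) (*-identityʳ p) ⟨
    (p * 1) % q  ≡⟨ p*1%q≡1 ⟩
    1 % q        ≡⟨ m<n⇒m%n≡m (<-trans 2≤p p<q) ⟩
    1            ∎

lemma4p3 : (q p p' : ℕ) → .{{_ : NonZero q}} → 2 ≤ q →
             1 ≤ p → p < q → gcd p q ≡ 1 →
             1 ≤ p' → p' < q → (p * p') % q ≡ 1 % q →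
             InΛ p q (thePoint p' q) ×
             InT₂ (thePoint p' q) ×
             (2 ≤ p → p ≤ q ∸ 2 → InT₁ (thePoint p' q))
lemma4p3 q p p' 2≤q _ p<q _ 1≤p' p'<q pp'≡1 =
  thePoint∈Λ p p' q (p * p' / q) (m%n≡1⇒m≡1+[m/n]*n (p * p') q 2≤q pp'≡1) ,
  thePoint∈t₂ p' q 1≤p' p'<q ,
  λ 2≤p _ → thePoint∈t₁ p' q (2≤p⇒2≤p' 2≤p p<q 1≤p' pp'≡1) (<⇒≤ p'<q)
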